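{- With the notation of the context, let $l$ be an integer with $3\le l\le m+3$. Then there is no integer $k$ with $\max(l-1,2)\le k\le m+2$ such that $v_{l,k}=a_k$ and $v_{l,k-1}>0$.
   Context: Let $a$ be a real number with infinite continued fraction expansion $[a_0;a_1,a_2,\dots]$ ($a_0\in\mathbb{Z}$, $a_i$ positive integers for $i\ge1$). Set $q_{ -1}=0$, $q_0=1$, $q_{k+1}=a_{k+1}q_k+q_{k-1}$. The Ostrowski representation of $N\in\mathbb{N}$ is the unique word $b_n\dots b_1$ with $N=\sum_{k=0}^{n}b_{k+1}q_k$, $b_k\in\mathbb{N}$, $b_1<a_1$, $b_k\le a_k$, and $b_{k-1}=0$ whenever $b_k=a_k$. A word is written $u_r\dots u_1$; $u_i$ is the entry at position $i$. Let $M,N\in\mathbb{N}$ have Ostrowski representations $x_n\dots x_1$, $y_n\dots y_1$ (padded with leading zeros to common length $n$). Let $m=n+1$, $s_i=x_i+y_i$ ($1\le i\le n$), $s_m=0$, $s=s_m\dots s_1$. Algorithm 1 defines $z_k=z_{k,m}\dots z_{k,1}$ for $k=m+1,\dots,3$ (decreasing). $z_{m+1}=s$. For $4\le k\le m$: $z_{k,i}=z_{k+1,i}$ for $i\notin\{k,k-1,k-2,k-3\}$, and (A1) if $z_{k+1,k}<a_k$, $z_{k+1,k-1}>a_{k-1}$, $z_{k+1,k-2}=0$: $(z_{k,k},z_{k,k-1},z_{k,k-2},z_{k,k-3})=(z_{k+1,k}+1,\ z_{k+1,k-1}-(a_{k-1}+1),\ a_{k-2}-1,\ z_{k+1,k-3}+1)$;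 (A2) if $z_{k+1,k}<a_k$, $a_{k-1}\le z_{k+1,k-1}\le 2a_{k-1}$, $z_{k+1,k-2}>0$: $(z_{k+1,k}+1,\ z_{k+1,k-1}-a_{k-1},\ z_{k+1,k-2}-1,\ z_{k+1,k-3})$; (A3) otherwise unchanged. For $k=3$: $z_{3,i}=z_{4,i}$ for $i\notin\{1,2,3\}$, and (B1) if $z_{4,3}<a_3$, $z_{4,2}>a_2$, $z_{4,1}=0$: $(z_{3,3},z_{3,2},z_{3,1})=(z_{4,3}+1,\ z_{4,2}-(a_2+1),\ a_1-1)$; (B2) if $z_{4,3}<a_3$, $z_{4,2}\ge a_2$, $a_1\ge z_{4,1}>0$: $(z_{4,3}+1,\ z_{4,2}-a_2,\ z_{4,1}-1)$; (B3) if $z_{4,3}<a_3$, $z_{4,2}\ge a_2$, $z_{4,1}>a_1$: $(z_{4,3}+1,\ z_{4,2}-a_2+1,\ z_{4,1}-a_1-1)$; (B4) if $z_{4,2}<a_2$, $z_{4,1}\ge a_1$: $(z_{4,3},\ z_{4,2}+1,\ z_{4,1}-a_1)$; (B5) otherwise unchanged. Algorithm 2 defines $w_k=w_{k,m+1}\dots w_{k,1}$ for $k=2,\dots,m+1$ (increasing). $w_2=0\,z_{3,m}\dots z_{3,1}$. For $3\le k\le m+1$: $w_{k,i}=w_{k-1,i}$ for $i\notin\{k,k-1,k-2\}$; if $w_{k-1,k}<a_k$, $w_{k-1,k-1}=a_{k-1}$, $w_{k-1,k-2}>0$, then $(w_{k,k},w_{k,k-1},w_{k,k-2})=(w_{k-1,k}+1,\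 0,\ w_{k-1,k-2}-1)$; otherwise unchanged. Algorithm 3 defines $v_k=v_{k,m+2}\dots v_{k,1}$ for $k=m+3,m+2,\dots,3$ (decreasing). $v_{m+3}=0\,w_{m+1,m+1}\dots w_{m+1,1}$. For $3\le k\le m+2$: $v_{k,i}=v_{k+1,i}$ for $i\notin\{k,k-1,k-2\}$; if $v_{k+1,k}<a_k$, $v_{k+1,k-1}=a_{k-1}$, $v_{k+1,k-2}>0$, then $(v_{k,k},v_{k,k-1},v_{k,k-2})=(v_{k+1,k}+1,\ 0,\ v_{k+1,k-2}-1)$; otherwise unchanged. -}

module Defs where

open import Data.Nat using (ℕ; zero; suc; _+_; _*_; _∸_; _≤_; _<_; _≤?_; _<?_; _≟_)
open import Data.Bool using (Bool; true; false; if_then_else_; _∧_)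
open import Relation.Nullary.Decidable using (⌊_⌋)
open import Relation.Binary.PropositionalEquality using (_≡_)

-- A word is a function from positions to digits; u i is the entry at position i.
-- Only finitely many positions are ever relevant.
Word : Set
Word = ℕ → ℕ

-- The partial quotients a₁, a₂, … of the continued fraction are given by
-- a : ℕ → ℕ with a i = aᵢ for i ≥ 1 (the value a 0 plays no role; a₀ ∈ ℤ is irrelevant).

q : (ℕ → ℕ) → ℕ → ℕ
q a zero = 1
q a (suc zero) = a 1
q a (suc (suc k)) = a (suc (suc k)) * q a (suc k) + q a k

ostValue : (ℕ → ℕ) → ℕ → Word → ℕ
ostValue a zero b = 0
ostValue a (suc n) b = ostValue a n b + b (suc n) * q a n

-- b_n … b_1 (entries at positions 1..n of b) is the Ostrowski representation of N
-- (possibly padded with leading zeros to length n).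
IsOstrowskiRep : (ℕ → ℕ) → ℕ → Word → ℕ → Set
IsOstrowskiRep a n b N =
  (ostValue a n b ≡ N)
  × (1 ≤ n → b 1 < a 1)
  × (∀ k → 1 ≤ k → k ≤ n → b k ≤ a k)
  × (∀ k → 2 ≤ k → k ≤ n → b k ≡ a k → b (k ∸ 1) ≡ 0)
  where open import Data.Product using (_×_)

-- s_i = x_i + y_i for 1 ≤ i ≤ n, and 0 elsewhere (in particular s_m = 0, m = n+1).
sWord : ℕ → Word → Word → Word
sWord n x y zero = 0
sWord n x y (suc i) = if ⌊ suc i ≤? n ⌋ then x (suc i) + y (suc i) else 0

upd : ℕ → ℕ → Word → Word
upd p c u i = if ⌊ i ≟ p ⌋ then c else u i

_<ᵇ_ _≤ᵇ_ _==_ : ℕ → ℕ → Bool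
m <ᵇ n = ⌊ m <? n ⌋
m ≤ᵇ n = ⌊ m ≤? n ⌋
m == n = ⌊ m ≟ n ⌋

-- Algorithm 1, step k ≥ 4 (rules A1, A2, A3), applied to z = z_{k+1}
stepA : (ℕ → ℕ) → ℕ → Word → Word
stepA a k z =
  if (z k <ᵇ a k) ∧ (a (k ∸ 1) <ᵇ z (k ∸ 1)) ∧ (z (k ∸ 2) == 0)
  then upd k (z k + 1) (upd (k ∸ 1) (z (k ∸ 1) ∸ (a (k ∸ 1) + 1))
         (upd (k ∸ 2) (a (k ∸ 2) ∸ 1) (upd (k ∸ 3) (z (k ∸ 3) + 1) z)))
  else if (z k <ᵇ a k) ∧ (a (k ∸ 1) ≤ᵇ z (k ∸ 1)) ∧ (z (k ∸ 1) ≤ᵇ (2 * a (k ∸ 1)))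
          ∧ (0 <ᵇ z (k ∸ 2))
  then upd k (z k + 1) (upd (k ∸ 1) (z (k ∸ 1) ∸ a (k ∸ 1))
         (upd (k ∸ 2) (z (k ∸ 2) ∸ 1) z))
  else z

-- Algorithm 1, step k = 3 (rules B1–B5), applied to z = z_4
stepB : (ℕ → ℕ) → Word → Word
stepB a z =
  if (z 3 <ᵇ a 3) ∧ (a 2 <ᵇ z 2) ∧ (z 1 == 0)
  then upd 3 (z 3 + 1) (upd 2 (z 2 ∸ (a 2 + 1)) (upd 1 (a 1 ∸ 1) z))
  else if (z 3 <ᵇ a 3) ∧ (a 2 ≤ᵇ z 2) ∧ (z 1 ≤ᵇ a 1) ∧ (0 <ᵇ z 1)
  then upd 3 (z 3 + 1) (upd 2 (z 2 ∸ a 2) (upd 1 (z 1 ∸ 1) z))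
  else if (z 3 <ᵇ a 3) ∧ (a 2 ≤ᵇ z 2) ∧ (a 1 <ᵇ z 1)
  then upd 3 (z 3 + 1) (upd 2 ((z 2 ∸ a 2) + 1) (upd 1 (z 1 ∸ (a 1 + 1)) z))
  else if (z 2 <ᵇ a 2) ∧ (a 1 ≤ᵇ z 1)
  then upd 2 (z 2 + 1) (upd 1 (z 1 ∸ a 1) z)
  else z

step1 : (ℕ → ℕ) → ℕ → Word → Word
step1 a k z = if k == 3 then stepB a z else stepA a k z

-- Step rule shared by Algorithms 2 and 3 at index k
step23 : (ℕ → ℕ) → ℕ → Word → Word
step23 a k u =
  if (u k <ᵇ a k) ∧ (u (k ∸ 1) == a (k ∸ 1)) ∧ (0 <ᵇ u (k ∸ 2))
  then upd k (u k + 1) (upd (k ∸ 1) 0 (upd (k ∸ 2) (u (k ∸ 2) ∸ 1) u))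
  else u

runDown : (ℕ → Word → Word) → ℕ → ℕ → Word → Word
runDown f k zero u = u
runDown f k (suc d) u = f k (runDown f (suc k) d u)

runUp : (ℕ → Word → Word) → ℕ → ℕ → Word → Word
runUp f k zero u = u
runUp f k (suc d) u = runUp f (suc k) d (f k u)

-- Algorithm 1: z_k for 3 ≤ k ≤ m+1, where m = n+1 and z_{m+1} = s
zSeq : (ℕ → ℕ) → ℕ → Word → Word → ℕ → Word
zSeq a n x y k = runDown (step1 a) k (suc n + 1 ∸ k) (sWord n x y)

-- Algorithm 2: w_{m+1} (w_2 = z_3, steps k = 3, …, m+1)
wFinal : (ℕ → ℕ) → ℕ → Word → Word → Word
wFinal a n x y = runUp (step23 a) 3 (suc n ∸ 1) (zSeq a n x y 3)

-- Algorithm 3: v_k for 3 ≤ k ≤ m+3 (v_{m+3} = w_{m+1}, steps m+2 down to k)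
vSeq : (ℕ → ℕ) → ℕ → Word → Word → ℕ → Word
vSeq a n x y k = runDown (step23 a) k (suc n + 3 ∸ k) (wFinal a n x y)

-- Let s be the digit-wise sum of the Ostrowski representations of
-- M and N.
--  1. Every digit s_{i+1}, even after adding one, is "capped" over s_i: it is at
--     most 2a_{i+1} + 1, with value 2a_{i+1} + 1 only if s_i = 0 and value 2a_{i+1}
--     only if s_i ≤ a_i (module DigitSum).
--  2. Algorithm 1 works downwards through s.  Its invariant (Alg1Inv) describes the
--     three digits just below the current step; it shows that the result z₃ is
--     bounded (z_{3,i} ≤ a_i for i ≥ 2) and vanishes above n + 1 (Algorithm1).
--  3. The carry rule of Algorithms 2 and 3 keeps words bounded (CarryRule).  The
--     upward sweep of Algorithm 2 leaves no "hazard", i.e. no digits a, 0, a, > 0 at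
--     four consecutive positions (Algorithm2).
--  4. On such a word the downward sweep of Algorithm 3 never leaves a full digit
--     above a nonzero one at or above the current position (Alg3Inv in Algorithm3);
--     this is the theorem (Pipeline, mainTheorem9).
module Submission where

open import Defs
open import Data.Nat using (ℕ; zero; suc; _+_; _*_; _∸_; _≤_; _<_; _⊔_; z≤n; s≤s; _≤?_; _<?_; _≟_)
open import Data.Nat.Properties
open import Data.Bool using (Bool; if_then_else_; _∧_)
open import Data.Product using (Σ; _×_; _,_; proj₁; proj₂; uncurry)
open import Data.Sum using (_⊎_; inj₁; inj₂; [_,_]′)
open import Data.Empty using (⊥-elim)
open import Relation.Nullary using (¬_; Dec; yes; no)
open import Relation.Nullary.Decidable using (⌊_⌋)
open import Relation.Binary.PropositionalEquality

upd-same : ∀ p c u → upd p c u p ≡ c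
upd-same p c u with p ≟ p
... | yes _   = refl
... | no p≢p = ⊥-elim (p≢p refl)

upd-other : ∀ p c u i → i ≢ p → upd p c u i ≡ u i
upd-other p c u i i≢p with i ≟ p
... | yes i≡p = ⊥-elim (i≢p i≡p)
... | no _    = refl

via : ∀ {v w : Word} {i r} → v ≡ w → w i ≡ r → v i ≡ r
via refl w≡r = w≡r

via-≤ : ∀ {v w : Word} {b} i → v ≡ w → w i ≤ b → v i ≤ b
via-≤ i refl w≤b = w≤b

Outside : ℕ → ℕ → ℕ → Set
Outside lo hi i = i < lo ⊎ hi < i

outside-≢ : ∀ {lo hi i p} → Outside lo hi i → lo ≤ p → p ≤ hi → i ≢ p
outside-≢ (inj₁ i<lo) lo≤p _    refl = <-irrefl refl (<-≤-trans i<lo lo≤p)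
outside-≢ (inj₂ hi<i) _    p≤hi refl = <-irrefl refl (≤-<-trans p≤hi hi<i)

Agree : ℕ → ℕ → Word → Word → Set
Agree lo hi v w = ∀ {i} → Outside lo hi i → v i ≡ w i

agree-refl : ∀ {lo hi} w → Agree lo hi w w
agree-refl w _ = refl

upd-agree : ∀ {lo hi p c v w} → lo ≤ p → p ≤ hi → Agree lo hi v w → Agree lo hi (upd p c v) w
upd-agree {p = p} {c} {v} lo≤p p≤hi v≈w {i} out =
  trans (upd-other p c v i (outside-≢ out lo≤p p≤hi)) (v≈w out)

IfCases : ∀ {A : Set} → Set → Bool → A → A → Set
IfCases P c x y = (P × (if c then x else y) ≡ x) ⊎ (¬ P × (if c then x else y) ≡ y)

guard₂ : ∀ {A P Q : Set} {x y : A} (p? : Dec P) (q? : Dec Q) →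
         IfCases (P × Q) (⌊ p? ⌋ ∧ ⌊ q? ⌋) x y
guard₂ (yes p) (yes q) = inj₁ ((p , q) , refl)
guard₂ (yes _) (no ¬q) = inj₂ ((λ (_ , q) → ¬q q) , refl)
guard₂ (no ¬p) _       = inj₂ ((λ (p , _) → ¬p p) , refl)

guard₃ : ∀ {A P Q R : Set} {x y : A} (p? : Dec P) (q? : Dec Q) (r? : Dec R) →
         IfCases (P × Q × R) (⌊ p? ⌋ ∧ ⌊ q? ⌋ ∧ ⌊ r? ⌋) x y
guard₃ (yes p) (yes q) (yes r) = inj₁ ((p , q , r) , refl)
guard₃ (yes _) (yes _) (no ¬r) = inj₂ ((λ (_ , _ , r) → ¬r r) , refl)
guard₃ (yes _) (no ¬q) _       = inj₂ ((λ (_ , q , _) → ¬q q) , refl)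
guard₃ (no ¬p) _       _       = inj₂ ((λ (p , _) → ¬p p) , refl)

guard₄ : ∀ {A P Q R S : Set} {x y : A} (p? : Dec P) (q? : Dec Q) (r? : Dec R) (s? : Dec S) →
         IfCases (P × Q × R × S) (⌊ p? ⌋ ∧ ⌊ q? ⌋ ∧ ⌊ r? ⌋ ∧ ⌊ s? ⌋) x y
guard₄ (yes p) (yes q) (yes r) (yes s) = inj₁ ((p , q , r , s) , refl)
guard₄ (yes _) (yes _) (yes _) (no ¬s) = inj₂ ((λ (_ , _ , _ , s) → ¬s s) , refl)
guard₄ (yes _) (yes _) (no ¬r) _       = inj₂ ((λ (_ , _ , r , _) → ¬r r) , refl)
guard₄ (yes _) (no ¬q) _       _       = inj₂ ((λ (_ , q , _) → ¬q q) , refl)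
guard₄ (no ¬p) _       _       _       = inj₂ ((λ (p , _) → ¬p p) , refl)

data Offset (i : ℕ) : ℕ → Set where
  offset : ∀ d → Offset i (d + i)

offset-of : ∀ {i j} → i ≤ j → Offset i j
offset-of {i} {j} i≤j = subst (Offset i) (trans (+-comm (j ∸ i) i) (m+[n∸m]≡n i≤j)) (offset (j ∸ i))

double : ∀ b → 2 * b ≡ b + b
double b = cong (b +_) (+-identityʳ b)

b≤2b : ∀ b → b ≤ 2 * b
b≤2b b = m≤m+n b (b + 0)

<⇒+1≤ : ∀ {x b} → x < b → x + 1 ≤ b
<⇒+1≤ {x} {b} x<b = subst (_≤ b) (+-comm 1 x) x<b

suc-∸1 : ∀ {x} → 0 < x → suc (x ∸ 1) ≡ x
suc-∸1 {suc x} _ = refl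

pred-below : ∀ {x b} → x ≤ b → 1 ≤ b → x ∸ 1 < b
pred-below {zero}  _   1≤b = 1≤b
pred-below {suc x} x<b _   = x<b

∸-halve : ∀ {x b} → x ≤ 2 * b → x ∸ b ≤ b
∸-halve {x} {b} x≤2b = m≤n+o⇒m∸n≤o x b (subst (x ≤_) (double b) x≤2b)

∸-halve-odd : ∀ {x b} → x ≤ suc (2 * b) → x ∸ (b + 1) ≤ b
∸-halve-odd {x} {b} x≤2b+1 = m≤n+o⇒m∸n≤o x (b + 1) (subst (x ≤_) 2b+1≡ x≤2b+1)
  where
  2b+1≡ : suc (2 * b) ≡ (b + 1) + b
  2b+1≡ = trans (cong suc (double b)) (cong (_+ b) (+-comm 1 b))

∸-halve-strict : ∀ {x b} → x < 2 * b → x ∸ b < b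
∸-halve-strict {x} {b} x<2b with b
... | zero  = ⊥-elim (n≮0 x<2b)
... | suc c = m<n+o⇒m∸n<o x (suc c) (subst (x <_) (double (suc c)) x<2b)

∸-halve-exact : ∀ {x b} → b ≤ x → x ∸ b ≡ b → x ≡ 2 * b
∸-halve-exact {x} {b} b≤x eq = begin
  x           ≡⟨ sym (m+[n∸m]≡n b≤x) ⟩
  b + (x ∸ b) ≡⟨ cong (b +_) eq ⟩
  b + b       ≡⟨ sym (double b) ⟩
  2 * b       ∎
  where open ≡-Reasoning

sum-double : ∀ {x y A} → x ≤ A → y ≤ A → x + y ≡ 2 * A → x ≡ A
sum-double {x} {y} {A} x≤A y≤A x+y≡2A with m≤n⇒m<n∨m≡n x≤A
... | inj₂ x≡A = x≡A
... | inj₁ x<A = ⊥-elim (<-irrefl (trans x+y≡2A (double A)) (+-mono-<-≤ x<A y≤A))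

sum-double-pred : ∀ {x y A} → x ≤ A → y ≤ A → suc (x + y) ≡ 2 * A → x ≡ A ⊎ y ≡ A
sum-double-pred {x} {y} {A} x≤A y≤A eq with m≤n⇒m<n∨m≡n x≤A | m≤n⇒m<n∨m≡n y≤A
... | inj₂ x≡A | _        = inj₁ x≡A
... | inj₁ _   | inj₂ y≡A = inj₂ y≡A
... | inj₁ x<A | inj₁ y<A = ⊥-elim (<-irrefl (trans eq (double A)) x+y+1<2A)
  where
  x+y+1<2A : suc (x + y) < A + A
  x+y+1<2A = subst (_≤ A + A) (cong suc (+-suc x y)) (+-mono-≤ x<A y<A)

-- Capped A A′ x y: a digit x with nominal bound A may overflow up to 2A + 1, but
-- only at the expense of the next lower digit y (nominal bound A′): the value
-- 2A + 1 forces y = 0 and the value 2A forces y ≤ A′.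
record Capped (A A′ x y : ℕ) : Set where
  field
    cap      : x ≤ suc (2 * A)
    atMax    : x ≡ suc (2 * A) → y ≡ 0
    atDouble : x ≡ 2 * A → y ≤ A′

open Capped public

capped-cong : ∀ {A A′ x x′ y y′} → x ≡ x′ → y ≡ y′ → Capped A A′ x y → Capped A A′ x′ y′
capped-cong refl refl c = c

capped-below : ∀ {A A′ x y} → x < A → Capped A A′ x y
cap      (capped-below {A} x<A) = ≤-trans (<⇒≤ x<A) (≤-trans (b≤2b A) (n≤1+n _))
atMax    (capped-below {A} x<A) refl = ⊥-elim (<-asym x<A (s≤s (b≤2b A)))
atDouble (capped-below {A} x<A) refl = ⊥-elim (<-irrefl refl (<-≤-trans x<A (b≤2b A)))

capped-pred : ∀ {A A′ x y} → Capped A A′ (suc x) y → Capped A A′ x y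
cap      (capped-pred c) = ≤-trans (n≤1+n _) (cap c)
atMax    (capped-pred c) refl = ⊥-elim (<-irrefl refl (cap c))
atDouble (capped-pred c) refl = subst (_≤ _) (sym (atMax c refl)) z≤n

capped-≤2A : ∀ {A A′ x y} → Capped A A′ x y → 0 < y → x ≤ 2 * A
capped-≤2A c 0<y with m≤n⇒m<n∨m≡n (cap c)
... | inj₁ x<2A+1 = ≤-pred x<2A+1
... | inj₂ x≡2A+1 = ⊥-elim (<-irrefl (sym (atMax c x≡2A+1)) 0<y)

quotient≢0 : ∀ {a : ℕ → ℕ} → (∀ i → 1 ≤ i → 1 ≤ a i) → ∀ i → a (suc i) ≢ 0
quotient≢0 a-pos i a≡0 = <-irrefl (sym a≡0) (a-pos (suc i) (s≤s z≤n))

Bounded : (ℕ → ℕ) → Word → Set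
Bounded a u = ∀ i → 2 ≤ i → u i ≤ a i

upd-bounded : ∀ {a p c w} → (2 ≤ p → c ≤ a p) → Bounded a w → Bounded a (upd p c w)
upd-bounded {p = p} c≤ap bw i 2≤i with i ≟ p
... | yes refl = c≤ap 2≤i
... | no _     = bw i 2≤i

module DigitSum (a : ℕ → ℕ) (a-pos : ∀ i → 1 ≤ i → 1 ≤ a i)
                (n : ℕ) (x y : Word) (M N : ℕ)
                (ox : IsOstrowskiRep a n x M) (oy : IsOstrowskiRep a n y N) where

  s : Word
  s = sWord n x y

  x-bound : ∀ k → 1 ≤ k → k ≤ n → x k ≤ a k
  x-bound = proj₁ (proj₂ (proj₂ ox))
  y-bound : ∀ k → 1 ≤ k → k ≤ n → y k ≤ a k
  y-bound = proj₁ (proj₂ (proj₂ oy))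
  x-maximal : ∀ k → 2 ≤ k → k ≤ n → x k ≡ a k → x (k ∸ 1) ≡ 0
  x-maximal = proj₂ (proj₂ (proj₂ ox))
  y-maximal : ∀ k → 2 ≤ k → k ≤ n → y k ≡ a k → y (k ∸ 1) ≡ 0
  y-maximal = proj₂ (proj₂ (proj₂ oy))

  s-inside : ∀ {i} → 1 ≤ i → i ≤ n → s i ≡ x i + y i
  s-inside {suc i} _ i≤n with suc i ≤? n
  ... | yes _   = refl
  ... | no i≰n = ⊥-elim (i≰n i≤n)

  s-outside : ∀ {i} → n < i → s i ≡ 0
  s-outside {suc i} n<i with suc i ≤? n
  ... | yes i≤n = ⊥-elim (<-irrefl refl (<-≤-trans n<i i≤n))
  ... | no _    = refl

  below-x-maximal : ∀ i → suc i ≤ n → x (suc i) ≡ a (suc i) → s i ≤ a i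
  below-x-maximal zero    _   _   = z≤n
  below-x-maximal (suc i) i<n max = begin
    s (suc i)             ≡⟨ s-inside (s≤s z≤n) (<⇒≤ i<n) ⟩
    x (suc i) + y (suc i) ≡⟨ cong (_+ y (suc i)) (x-maximal (2 + i) (s≤s (s≤s z≤n)) i<n max) ⟩
    y (suc i)             ≤⟨ y-bound (suc i) (s≤s z≤n) (<⇒≤ i<n) ⟩
    a (suc i)             ∎
    where open ≤-Reasoning

  below-y-maximal : ∀ i → suc i ≤ n → y (suc i) ≡ a (suc i) → s i ≤ a i
  below-y-maximal zero    _   _   = z≤n
  below-y-maximal (suc i) i<n max = begin
    s (suc i)             ≡⟨ s-inside (s≤s z≤n) (<⇒≤ i<n) ⟩
    x (suc i) + y (suc i) ≡⟨ cong (x (suc i) +_) (y-maximal (2 + i) (s≤s (s≤s z≤n)) i<n max) ⟩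
    x (suc i) + 0         ≡⟨ +-identityʳ _ ⟩
    x (suc i)             ≤⟨ x-bound (suc i) (s≤s z≤n) (<⇒≤ i<n) ⟩
    a (suc i)             ∎
    where open ≤-Reasoning

  below-both-maximal : ∀ i → suc i ≤ n → x (suc i) ≡ a (suc i) → y (suc i) ≡ a (suc i) → s i ≡ 0
  below-both-maximal zero    _   _    _    = refl
  below-both-maximal (suc i) i<n xmax ymax = begin
    s (suc i)             ≡⟨ s-inside (s≤s z≤n) (<⇒≤ i<n) ⟩
    x (suc i) + y (suc i) ≡⟨ cong₂ _+_ (x-maximal (2 + i) (s≤s (s≤s z≤n)) i<n xmax)
                                       (y-maximal (2 + i) (s≤s (s≤s z≤n)) i<n ymax) ⟩
    0                     ∎
    where open ≡-Reasoning

  -- Inside the representations the cap comes from the bounds and the maximality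
  -- condition on digits; above them s_{i+1} + 1 = 1 is capped since a_{i+1} ≥ 1.
  s-capped : ∀ i → Capped (a (suc i)) (a i) (suc (s (suc i))) (s i)
  s-capped i with suc i ≤? n
  ... | yes i<n = record { cap = s≤s x+y≤2A ; atMax = at-max ; atDouble = at-double }
    where
    x≤A : x (suc i) ≤ a (suc i)
    x≤A = x-bound (suc i) (s≤s z≤n) i<n
    y≤A : y (suc i) ≤ a (suc i)
    y≤A = y-bound (suc i) (s≤s z≤n) i<n
    x+y≤2A : x (suc i) + y (suc i) ≤ 2 * a (suc i)
    x+y≤2A = subst (x (suc i) + y (suc i) ≤_) (sym (double (a (suc i)))) (+-mono-≤ x≤A y≤A)
    at-max : suc (x (suc i) + y (suc i)) ≡ suc (2 * a (suc i)) → s i ≡ 0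
    at-max eq = below-both-maximal i i<n (sum-double x≤A y≤A (suc-injective eq))
                  (sum-double y≤A x≤A (trans (+-comm (y (suc i)) (x (suc i))) (suc-injective eq)))
    at-double : suc (x (suc i) + y (suc i)) ≡ 2 * a (suc i) → s i ≤ a i
    at-double eq with sum-double-pred x≤A y≤A eq
    ... | inj₁ xmax = below-x-maximal i i<n xmax
    ... | inj₂ ymax = below-y-maximal i i<n ymax
  ... | no _ = record { cap = s≤s z≤n ; atMax = at-max ; atDouble = at-double }
    where
    at-max : 1 ≡ suc (2 * a (suc i)) → s i ≡ 0
    at-max eq = ⊥-elim (quotient≢0 a-pos i (m+n≡0⇒m≡0 _ (sym (suc-injective eq))))
    at-double : 1 ≡ 2 * a (suc i) → s i ≤ a i
    at-double eq with a (suc i)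
    at-double () | zero
    at-double eq | suc A = ⊥-elim (1+n≢0 (sym (trans (suc-injective eq) (+-suc A (A + 0)))))

module Algorithm1 (a : ℕ → ℕ) (a-pos : ∀ i → 1 ≤ i → 1 ≤ a i) (n : ℕ) (s : Word)
                  (s-outside : ∀ {i} → n < i → s i ≡ 0)
                  (s-capped : ∀ i → Capped (a (suc i)) (a i) (suc (s (suc i))) (s i)) where

  s-capped-digit : ∀ i → Capped (a (suc i)) (a i) (s (suc i)) (s i)
  s-capped-digit i = capped-pred (s-capped i)

  -- The situation right after the step at 4 + j, i.e. for u = z_{4+j}: positions
  -- ≥ 4 + j are settled, positions ≤ j still hold s, and in the window the digit at
  -- 3 + j is bounded (with room below it when full), the digit at 2 + j is capped
  -- over the one at 1 + j, and that one is capped over s_j.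
  record Alg1Inv (j : ℕ) (u : Word) : Set where
    field
      settled   : ∀ i → 4 + j ≤ i → u i ≤ a i
      vanish    : ∀ i → 2 + n ≤ i → u i ≡ 0
      untouched : ∀ i → i ≤ j → u i ≡ s i
      top       : u (3 + j) ≤ a (3 + j)
      topFull   : u (3 + j) ≡ a (3 + j) → u (2 + j) < a (2 + j)
      middle    : Capped (a (2 + j)) (a (1 + j)) (u (2 + j)) (u (1 + j))
      bottom    : Capped (a (1 + j)) (a j) (u (1 + j)) (s j)

  open Alg1Inv

  -- Before any step (z_{m+1} = s, where m + 1 = 4 + j) the invariant holds.
  alg1-start : ∀ j → 2 + j ≡ n → Alg1Inv j s
  alg1-start j refl = record
    { settled   = λ i 4+j≤i → subst (_≤ a i) (sym (s-outside (n<i 4+j≤i))) z≤n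
    ; vanish    = λ i 4+j≤i → s-outside (n<i 4+j≤i)
    ; untouched = λ _ _ → refl
    ; top       = subst (_≤ a (3 + j)) (sym (s-outside ≤-refl)) z≤n
    ; topFull   = λ full → ⊥-elim (quotient≢0 a-pos (2 + j) (trans (sym full) (s-outside ≤-refl)))
    ; middle    = s-capped-digit (1 + j)
    ; bottom    = s-capped-digit j
    }
    where
    n<i : ∀ {i} → 4 + j ≤ i → 2 + j < i
    n<i = ≤-trans (n≤1+n _)

  CondA1 CondA2 : ℕ → Word → Set
  CondA1 j u = u (4 + j) < a (4 + j) × a (3 + j) < u (3 + j) × u (2 + j) ≡ 0
  CondA2 j u = u (4 + j) < a (4 + j) × a (3 + j) ≤ u (3 + j) × u (3 + j) ≤ 2 * a (3 + j)
             × 0 < u (2 + j)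

  resultA1 resultA2 : ℕ → Word → Word
  resultA1 j u = upd (4 + j) (u (4 + j) + 1) (upd (3 + j) (u (3 + j) ∸ (a (3 + j) + 1))
                   (upd (2 + j) (a (2 + j) ∸ 1) (upd (1 + j) (u (1 + j) + 1) u)))
  resultA2 j u = upd (4 + j) (u (4 + j) + 1) (upd (3 + j) (u (3 + j) ∸ a (3 + j))
                   (upd (2 + j) (u (2 + j) ∸ 1) u))

  data RuleA (j : ℕ) (u : Word) : Set where
    ruleA1 : CondA1 j u → stepA a (4 + j) u ≡ resultA1 j u → RuleA j u
    ruleA2 : CondA2 j u → stepA a (4 + j) u ≡ resultA2 j u → RuleA j u
    ruleA3 : ¬ CondA1 j u → ¬ CondA2 j u → stepA a (4 + j) u ≡ u → RuleA j u

  ruleA : ∀ j u → RuleA j u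
  ruleA j u =
    [ uncurry ruleA1
    , (λ (¬c₁ , eq₁) →
        [ (λ (c₂ , eq₂) → ruleA2 c₂ (trans eq₁ eq₂))
        , (λ (¬c₂ , eq₂) → ruleA3 ¬c₁ ¬c₂ (trans eq₁ eq₂))
        ]′ (guard₄ (u (4 + j) <? a (4 + j)) (a (3 + j) ≤? u (3 + j))
                   (u (3 + j) ≤? 2 * a (3 + j)) (0 <? u (2 + j))))
    ]′ (guard₃ (u (4 + j) <? a (4 + j)) (a (3 + j) <? u (3 + j)) (u (2 + j) ≟ 0))

  stepA-agree : ∀ j u → Agree (1 + j) (4 + j) (stepA a (4 + j) u) u
  stepA-agree j u {i} out with ruleA j u
  ... | ruleA1 _ eq = trans (cong-app eq i)
        (upd-agree (m≤n+m _ 3) ≤-refl (upd-agree (m≤n+m _ 2) (m≤n+m _ 1)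
          (upd-agree (m≤n+m _ 1) (m≤n+m _ 2) (upd-agree ≤-refl (m≤n+m _ 3) (agree-refl u)))) out)
  ... | ruleA2 _ eq = trans (cong-app eq i)
        (upd-agree (m≤n+m _ 3) ≤-refl (upd-agree (m≤n+m _ 2) (m≤n+m _ 1)
          (upd-agree (m≤n+m _ 1) (m≤n+m _ 2) (agree-refl u))) out)
  ... | ruleA3 _ _ eq = cong-app eq i

  module ResultA1 (j : ℕ) (u : Word) where
    private
      w₁ w₂ w₃ : Word
      w₁ = upd (1 + j) (u (1 + j) + 1) u
      w₂ = upd (2 + j) (a (2 + j) ∸ 1) w₁
      w₃ = upd (3 + j) (u (3 + j) ∸ (a (3 + j) + 1)) w₂

    at-4 : resultA1 j u (4 + j) ≡ u (4 + j) + 1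
    at-4 = upd-same (4 + j) _ w₃

    at-3 : resultA1 j u (3 + j) ≡ u (3 + j) ∸ (a (3 + j) + 1)
    at-3 = trans (upd-other (4 + j) _ w₃ (3 + j) (λ ())) (upd-same (3 + j) _ w₂)

    at-2 : resultA1 j u (2 + j) ≡ a (2 + j) ∸ 1
    at-2 = trans (upd-other (4 + j) _ w₃ (2 + j) (λ ()))
             (trans (upd-other (3 + j) _ w₂ (2 + j) (λ ())) (upd-same (2 + j) _ w₁))

    at-1 : resultA1 j u (1 + j) ≡ u (1 + j) + 1
    at-1 = trans (upd-other (4 + j) _ w₃ (1 + j) (λ ()))
             (trans (upd-other (3 + j) _ w₂ (1 + j) (λ ()))
               (trans (upd-other (2 + j) _ w₁ (1 + j) (λ ())) (upd-same (1 + j) _ u)))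

  module ResultA2 (j : ℕ) (u : Word) where
    private
      w₁ w₂ : Word
      w₁ = upd (2 + j) (u (2 + j) ∸ 1) u
      w₂ = upd (3 + j) (u (3 + j) ∸ a (3 + j)) w₁

    at-4 : resultA2 j u (4 + j) ≡ u (4 + j) + 1
    at-4 = upd-same (4 + j) _ w₂

    at-3 : resultA2 j u (3 + j) ≡ u (3 + j) ∸ a (3 + j)
    at-3 = trans (upd-other (4 + j) _ w₂ (3 + j) (λ ())) (upd-same (3 + j) _ w₁)

    at-2 : resultA2 j u (2 + j) ≡ u (2 + j) ∸ 1
    at-2 = trans (upd-other (4 + j) _ w₂ (2 + j) (λ ()))
             (trans (upd-other (3 + j) _ w₁ (2 + j) (λ ())) (upd-same (2 + j) _ u))

    at-1 : resultA2 j u (1 + j) ≡ u (1 + j)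
    at-1 = trans (upd-other (4 + j) _ w₂ (1 + j) (λ ()))
             (trans (upd-other (3 + j) _ w₁ (1 + j) (λ ())) (upd-other (2 + j) _ u (1 + j) (λ ())))

  module Alg1Step (j : ℕ) (u : Word) (room : 4 + j ≤ 1 + n) (old : Alg1Inv (suc j) u) where

    v : Word
    v = stepA a (4 + j) u

    uT≡sT : u (1 + j) ≡ s (1 + j)
    uT≡sT = untouched old (1 + j) ≤-refl

    vanish′ : ∀ i → 2 + n ≤ i → v i ≡ 0
    vanish′ i 2+n≤i = trans (stepA-agree j u (inj₂ (≤-trans (s≤s room) 2+n≤i))) (vanish old i 2+n≤i)

    untouched′ : ∀ i → i ≤ j → v i ≡ s i
    untouched′ i i≤j = trans (stepA-agree j u (inj₁ (s≤s i≤j))) (untouched old i (m≤n⇒m≤1+n i≤j))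

    settled′ : v (4 + j) ≤ a (4 + j) → ∀ i → 4 + j ≤ i → v i ≤ a i
    settled′ vP≤aP i 4+j≤i with m≤n⇒m<n∨m≡n 4+j≤i
    ... | inj₂ refl  = vP≤aP
    ... | inj₁ 4+j<i = subst (_≤ a i) (sym (stepA-agree j u (inj₂ 4+j<i))) (settled old i 4+j<i)

    after-A1 : CondA1 j u → v ≡ resultA1 j u → Alg1Inv j v
    after-A1 (uP<aP , _ , _) eq = record
      { settled   = settled′ (subst (_≤ a (4 + j)) (sym vP) (<⇒+1≤ uP<aP))
      ; vanish    = vanish′
      ; untouched = untouched′
      ; top       = subst (_≤ a (3 + j)) (sym vQ) (∸-halve-odd (cap (middle old)))
      ; topFull   = λ _ → subst (_< a (2 + j)) (sym vR) aR-1<aR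
      ; middle    = capped-cong (sym vR) refl (capped-below aR-1<aR)
      ; bottom    = capped-cong (sym vT) refl (s-capped j)
      }
      where
      open ResultA1 j u
      vP : v (4 + j) ≡ u (4 + j) + 1
      vP = via eq at-4
      vQ : v (3 + j) ≡ u (3 + j) ∸ (a (3 + j) + 1)
      vQ = via eq at-3
      vR : v (2 + j) ≡ a (2 + j) ∸ 1
      vR = via eq at-2
      vT : v (1 + j) ≡ suc (s (1 + j))
      vT = via eq (trans at-1 (trans (cong (_+ 1) uT≡sT) (+-comm _ 1)))
      aR-1<aR : a (2 + j) ∸ 1 < a (2 + j)
      aR-1<aR = pred-below ≤-refl (a-pos (2 + j) (s≤s z≤n))

    after-A2 : CondA2 j u → v ≡ resultA2 j u → Alg1Inv j v
    after-A2 (uP<aP , aQ≤uQ , uQ≤2aQ , 0<uR) eq = record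
      { settled   = settled′ (subst (_≤ a (4 + j)) (sym vP) (<⇒+1≤ uP<aP))
      ; vanish    = vanish′
      ; untouched = untouched′
      ; top       = subst (_≤ a (3 + j)) (sym vQ) (∸-halve uQ≤2aQ)
      ; topFull   = top-full
      ; middle    = capped-cong (sym vR) (sym vT)
                      (capped-pred (capped-cong (sym (suc-∸1 0<uR)) refl (bottom old)))
      ; bottom    = capped-cong (sym vT) refl (s-capped-digit j)
      }
      where
      open ResultA2 j u
      vP : v (4 + j) ≡ u (4 + j) + 1
      vP = via eq at-4
      vQ : v (3 + j) ≡ u (3 + j) ∸ a (3 + j)
      vQ = via eq at-3
      vR : v (2 + j) ≡ u (2 + j) ∸ 1
      vR = via eq at-2
      vT : v (1 + j) ≡ s (1 + j)
      vT = via eq (trans at-1 uT≡sT)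
      -- a full digit at 3 + j means u_{3+j} = 2a_{3+j}, which bounds u_{2+j} by a_{2+j}
      top-full : v (3 + j) ≡ a (3 + j) → v (2 + j) < a (2 + j)
      top-full full = subst (_< a (2 + j)) (sym vR)
        (pred-below (atDouble (middle old) (∸-halve-exact aQ≤uQ (trans (sym vQ) full)))
                    (a-pos (2 + j) (s≤s z≤n)))

    -- When neither A1 nor A2 applies, the window is already in shape: a digit at
    -- 3 + j reaching its bound has room above it, so it cannot overflow (else A1 or
    -- A2 would fire) and, when full, the digit below it is small.
    room-above : a (3 + j) ≤ u (3 + j) → u (4 + j) < a (4 + j)
    room-above aQ≤uQ = ≤∧≢⇒< (top old) (λ full → <⇒≱ (topFull old full) aQ≤uQ)

    no-overflow : ¬ CondA1 j u → ¬ CondA2 j u → u (3 + j) ≤ a (3 + j)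
    no-overflow ¬c₁ ¬c₂ with u (3 + j) ≤? a (3 + j)
    ... | yes uQ≤aQ = uQ≤aQ
    ... | no uQ≰aQ with ≰⇒> uQ≰aQ | u (2 + j) ≟ 0
    ...   | aQ<uQ | yes uR≡0 = ⊥-elim (¬c₁ (room-above (<⇒≤ aQ<uQ) , aQ<uQ , uR≡0))
    ...   | aQ<uQ | no uR≢0  = ⊥-elim (¬c₂ (room-above (<⇒≤ aQ<uQ) , <⇒≤ aQ<uQ ,
                                         capped-≤2A (middle old) (n≢0⇒n>0 uR≢0) , n≢0⇒n>0 uR≢0))

    no-full-carry : ¬ CondA2 j u → u (3 + j) ≡ a (3 + j) → u (2 + j) < a (2 + j)
    no-full-carry ¬c₂ full with u (2 + j) ≟ 0
    ... | yes uR≡0 = subst (_< a (2 + j)) (sym uR≡0) (a-pos (2 + j) (s≤s z≤n))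
    ... | no uR≢0  = ⊥-elim (¬c₂ (room-above aQ≤uQ , aQ≤uQ , uQ≤2aQ , n≢0⇒n>0 uR≢0))
      where
      aQ≤uQ : a (3 + j) ≤ u (3 + j)
      aQ≤uQ = ≤-reflexive (sym full)
      uQ≤2aQ : u (3 + j) ≤ 2 * a (3 + j)
      uQ≤2aQ = subst (_≤ 2 * a (3 + j)) (sym full) (b≤2b _)

    after-A3 : ¬ CondA1 j u → ¬ CondA2 j u → v ≡ u → Alg1Inv j v
    after-A3 ¬c₁ ¬c₂ eq = record
      { settled   = settled′ (via-≤ (4 + j) eq (top old))
      ; vanish    = vanish′
      ; untouched = untouched′
      ; top       = via-≤ (3 + j) eq (no-overflow ¬c₁ ¬c₂)
      ; topFull   = λ full → subst (_< a (2 + j)) (sym (cong-app eq (2 + j)))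
                               (no-full-carry ¬c₂ (trans (sym (cong-app eq (3 + j))) full))
      ; middle    = capped-cong (sym (cong-app eq (2 + j))) (sym vT) (bottom old)
      ; bottom    = capped-cong (sym vT) refl (s-capped-digit j)
      }
      where
      vT : v (1 + j) ≡ s (1 + j)
      vT = via eq uT≡sT

  alg1-step : ∀ j u → 4 + j ≤ 1 + n → Alg1Inv (suc j) u → Alg1Inv j (stepA a (4 + j) u)
  alg1-step j u room old with ruleA j u
  ... | ruleA1 c eq       = Alg1Step.after-A1 j u room old c eq
  ... | ruleA2 c eq       = Alg1Step.after-A2 j u room old c eq
  ... | ruleA3 ¬c₁ ¬c₂ eq = Alg1Step.after-A3 j u room old ¬c₁ ¬c₂ eq

  alg1-run : ∀ d j → 4 + j + d ≡ 2 + n → Alg1Inv j (runDown (step1 a) (4 + j) d s)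
  alg1-run zero    j eq = alg1-start j (suc-injective (suc-injective (trans (sym (+-identityʳ _)) eq)))
  alg1-run (suc d) j eq = alg1-step j _ room (alg1-run d (suc j) eq′)
    where
    eq′ : 4 + suc j + d ≡ 2 + n
    eq′ = trans (cong (4 +_) (sym (+-suc j d))) eq
    j<j+1+d : suc j ≤ j + suc d
    j<j+1+d = subst (suc j ≤_) (sym (+-suc j d)) (s≤s (m≤m+n j d))
    room : 4 + j ≤ 1 + n
    room = ≤-pred (subst (5 + j ≤_) eq (s≤s (s≤s (s≤s (s≤s j<j+1+d)))))

  CondB1 CondB2 CondB3 CondB4 : Word → Set
  CondB1 u = u 3 < a 3 × a 2 < u 2 × u 1 ≡ 0
  CondB2 u = u 3 < a 3 × a 2 ≤ u 2 × u 1 ≤ a 1 × 0 < u 1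
  CondB3 u = u 3 < a 3 × a 2 ≤ u 2 × a 1 < u 1
  CondB4 u = u 2 < a 2 × a 1 ≤ u 1

  data RuleB (u : Word) : Set where
    ruleB1 : CondB1 u → stepB a u ≡ upd 3 (u 3 + 1) (upd 2 (u 2 ∸ (a 2 + 1)) (upd 1 (a 1 ∸ 1) u))
           → RuleB u
    ruleB2 : CondB2 u → stepB a u ≡ upd 3 (u 3 + 1) (upd 2 (u 2 ∸ a 2) (upd 1 (u 1 ∸ 1) u))
           → RuleB u
    ruleB3 : CondB3 u
           → stepB a u ≡ upd 3 (u 3 + 1) (upd 2 ((u 2 ∸ a 2) + 1) (upd 1 (u 1 ∸ (a 1 + 1)) u))
           → RuleB u
    ruleB4 : CondB4 u → stepB a u ≡ upd 2 (u 2 + 1) (upd 1 (u 1 ∸ a 1) u) → RuleB u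
    ruleB5 : ¬ CondB1 u → ¬ CondB2 u → ¬ CondB3 u → ¬ CondB4 u → stepB a u ≡ u → RuleB u

  ruleB : ∀ u → RuleB u
  ruleB u =
    [ uncurry ruleB1
    , (λ (¬c₁ , eq₁) →
      [ (λ (c₂ , eq₂) → ruleB2 c₂ (trans eq₁ eq₂))
      , (λ (¬c₂ , eq₂) →
        [ (λ (c₃ , eq₃) → ruleB3 c₃ (trans eq₁ (trans eq₂ eq₃)))
        , (λ (¬c₃ , eq₃) →
          [ (λ (c₄ , eq₄) → ruleB4 c₄ (trans eq₁ (trans eq₂ (trans eq₃ eq₄))))
          , (λ (¬c₄ , eq₄) → ruleB5 ¬c₁ ¬c₂ ¬c₃ ¬c₄ (trans eq₁ (trans eq₂ (trans eq₃ eq₄))))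
          ]′ (guard₂ (u 2 <? a 2) (a 1 ≤? u 1)))
        ]′ (guard₃ (u 3 <? a 3) (a 2 ≤? u 2) (a 1 <? u 1)))
      ]′ (guard₄ (u 3 <? a 3) (a 2 ≤? u 2) (u 1 ≤? a 1) (0 <? u 1)))
    ]′ (guard₃ (u 3 <? a 3) (a 2 <? u 2) (u 1 ≟ 0))

  -- The last step only touches positions 1, 2, 3.  (Inside, the digits of the
  -- results can be read off by computation, since the positions are literals.)
  updates-1-2 : ∀ u c₂ c₁ → Agree 1 3 (upd 2 c₂ (upd 1 c₁ u)) u
  updates-1-2 u c₂ c₁ =
    upd-agree (s≤s z≤n) (s≤s (s≤s z≤n)) (upd-agree ≤-refl (s≤s z≤n) (agree-refl u))

  updates-1-3 : ∀ u c₃ c₂ c₁ → Agree 1 3 (upd 3 c₃ (upd 2 c₂ (upd 1 c₁ u))) u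
  updates-1-3 u c₃ c₂ c₁ = upd-agree (s≤s z≤n) ≤-refl (updates-1-2 u c₂ c₁)

  stepB-agree : ∀ u → Agree 1 3 (stepB a u) u
  stepB-agree u {i} out with ruleB u
  ... | ruleB1 _ eq       = trans (cong-app eq i) (updates-1-3 u _ _ _ out)
  ... | ruleB2 _ eq       = trans (cong-app eq i) (updates-1-3 u _ _ _ out)
  ... | ruleB3 _ eq       = trans (cong-app eq i) (updates-1-3 u _ _ _ out)
  ... | ruleB4 _ eq       = trans (cong-app eq i) (updates-1-2 u _ _ out)
  ... | ruleB5 _ _ _ _ eq = cong-app eq i

  module LastStep (u : Word) (inv : Alg1Inv 0 u) where

    -- As for the steps A: an overflowing digit at 2 has room above it, so B1, B2 or
    -- B3 would fire.
    room-above : a 2 < u 2 → u 3 < a 3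
    room-above a2<u2 = ≤∧≢⇒< (top inv) (λ full → <⇒≱ (topFull inv full) (<⇒≤ a2<u2))

    no-overflow : ¬ CondB1 u → ¬ CondB2 u → ¬ CondB3 u → u 2 ≤ a 2
    no-overflow ¬c₁ ¬c₂ ¬c₃ with u 2 ≤? a 2
    ... | yes u2≤a2 = u2≤a2
    ... | no u2≰a2 with ≰⇒> u2≰a2 | u 1 ≟ 0 | u 1 ≤? a 1
    ...   | a2<u2 | yes u1≡0 | _         = ⊥-elim (¬c₁ (room-above a2<u2 , a2<u2 , u1≡0))
    ...   | a2<u2 | no u1≢0  | yes u1≤a1 =
            ⊥-elim (¬c₂ (room-above a2<u2 , <⇒≤ a2<u2 , u1≤a1 , n≢0⇒n>0 u1≢0))
    ...   | a2<u2 | no _     | no u1≰a1  = ⊥-elim (¬c₃ (room-above a2<u2 , <⇒≤ a2<u2 , ≰⇒> u1≰a1))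

    after-B : stepB a u 3 ≤ a 3 × stepB a u 2 ≤ a 2
    after-B with ruleB u
    ... | ruleB1 (u3<a3 , _ , _) eq =
          via-≤ 3 eq (<⇒+1≤ u3<a3) , via-≤ 2 eq (∸-halve-odd (cap (middle inv)))
    ... | ruleB2 (u3<a3 , _ , _ , 0<u1) eq =
          via-≤ 3 eq (<⇒+1≤ u3<a3) , via-≤ 2 eq (∸-halve (capped-≤2A (middle inv) 0<u1))
    ... | ruleB3 (u3<a3 , _ , a1<u1) eq =
          via-≤ 3 eq (<⇒+1≤ u3<a3) , via-≤ 2 eq (<⇒+1≤ (∸-halve-strict u2<2a2))
      where
      u2<2a2 : u 2 < 2 * a 2
      u2<2a2 = ≤∧≢⇒< (capped-≤2A (middle inv) (≤-<-trans z≤n a1<u1))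
                      (λ u2≡2a2 → <⇒≱ a1<u1 (atDouble (middle inv) u2≡2a2))
    ... | ruleB4 (u2<a2 , _) eq = via-≤ 3 eq (top inv) , via-≤ 2 eq (<⇒+1≤ u2<a2)
    ... | ruleB5 ¬c₁ ¬c₂ ¬c₃ _ eq = via-≤ 3 eq (top inv) , via-≤ 2 eq (no-overflow ¬c₁ ¬c₂ ¬c₃)

  alg1-result : ∀ d → 3 + d ≡ 2 + n →
    Bounded a (runDown (step1 a) 3 d s) × (∀ i → 2 + n ≤ i → runDown (step1 a) 3 d s i ≡ 0)
  -- For n = 1 no step is performed and z₃ = s.
  alg1-result zero refl =
    (λ i 2≤i → subst (_≤ a i) (sym (s-outside 2≤i)) z≤n) ,
    (λ i 3≤i → s-outside (≤-trans (n≤1+n 2) 3≤i))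
  alg1-result (suc d) eq = bounded , vanishing
    where
    u : Word
    u = runDown (step1 a) 4 d s
    inv : Alg1Inv 0 u
    inv = alg1-run d 0 eq
    open LastStep u inv using (after-B)
    bounded : Bounded a (stepB a u)
    bounded 1 (s≤s ())
    bounded 2 _ = proj₂ after-B
    bounded 3 _ = proj₁ after-B
    bounded (suc (suc (suc (suc i)))) _ =
      subst (_≤ a (4 + i)) (sym (stepB-agree u (inj₂ (s≤s (s≤s (s≤s (s≤s z≤n)))))))
            (settled inv (4 + i) (s≤s (s≤s (s≤s (s≤s z≤n)))))
    4≤2+n : 4 ≤ 2 + n
    4≤2+n = subst (4 ≤_) eq (s≤s (s≤s (s≤s (s≤s z≤n))))
    vanishing : ∀ i → 2 + n ≤ i → stepB a u i ≡ 0
    vanishing i 2+n≤i = trans (stepB-agree u (inj₂ (≤-trans 4≤2+n 2+n≤i))) (vanish inv i 2+n≤i)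

module CarryRule (a : ℕ → ℕ) (a-pos : ∀ i → 1 ≤ i → 1 ≤ a i) where

  a≢0 : ∀ i → a (suc i) ≢ 0
  a≢0 = quotient≢0 a-pos

  Fires : ℕ → Word → Set
  Fires j u = u (3 + j) < a (3 + j) × u (2 + j) ≡ a (2 + j) × 0 < u (1 + j)

  carried : ℕ → Word → Word
  carried j u = upd (3 + j) (u (3 + j) + 1) (upd (2 + j) 0 (upd (1 + j) (u (1 + j) ∸ 1) u))

  data Carry (j : ℕ) (u : Word) : Set where
    fires : Fires j u → step23 a (3 + j) u ≡ carried j u → Carry j u
    idle  : ¬ Fires j u → step23 a (3 + j) u ≡ u → Carry j u

  carry : ∀ j u → Carry j u
  carry j u = [ uncurry fires , uncurry idle ]′
    (guard₃ (u (3 + j) <? a (3 + j)) (u (2 + j) ≟ a (2 + j)) (0 <? u (1 + j)))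

  carry-agree : ∀ j u → Agree (1 + j) (3 + j) (step23 a (3 + j) u) u
  carry-agree j u {i} out with carry j u
  ... | fires _ eq = trans (cong-app eq i)
        (upd-agree (m≤n+m _ 2) ≤-refl (upd-agree (m≤n+m _ 1) (m≤n+m _ 1)
          (upd-agree ≤-refl (m≤n+m _ 2) (agree-refl u))) out)
  ... | idle _ eq = cong-app eq i

  carry-bounded : ∀ j u → Bounded a u → Bounded a (step23 a (3 + j) u)
  carry-bounded j u bu i 2≤i with carry j u
  ... | fires (u3<a3 , _ , _) eq = via-≤ i eq
        (upd-bounded (λ _ → <⇒+1≤ u3<a3) (upd-bounded (λ _ → z≤n)
          (upd-bounded (λ 2≤1+j → ≤-trans (m∸n≤m _ 1) (bu (1 + j) 2≤1+j)) bu)) i 2≤i)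
  ... | idle _ eq = via-≤ i eq (bu i 2≤i)

  -- Hazard u i: the digits (a, 0, a, > 0) at positions 4 + i … 1 + i.  A carry at
  -- 3 + i would turn them into the forbidden pair (a_{4+i}, 1) at (4 + i, 3 + i).
  Hazard : Word → ℕ → Set
  Hazard u i = u (4 + i) ≡ a (4 + i) × u (3 + i) ≡ 0 × u (2 + i) ≡ a (2 + i) × 0 < u (1 + i)

  hazard-fires : ∀ {u j} → Hazard u j → Fires j u
  hazard-fires {j = j} (_ , u3≡0 , u2-full , 0<u1) =
    subst (_< a (3 + j)) (sym u3≡0) (a-pos (3 + j) (s≤s z≤n)) , u2-full , 0<u1

  hazard-agree : ∀ {u v i} → (∀ p → p < 5 + i → v p ≡ u p) → Hazard v i → Hazard u i
  hazard-agree {i = i} v≈u (e₄ , e₃ , e₂ , e₁) =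
      trans (sym (v≈u (4 + i) ≤-refl)) e₄
    , trans (sym (v≈u (3 + i) (m≤n+m _ 1))) e₃
    , trans (sym (v≈u (2 + i) (m≤n+m _ 2))) e₂
    , subst (0 <_) (v≈u (1 + i) (m≤n+m _ 3)) e₁

  module AfterCarry (j : ℕ) (u : Word) (bu : Bounded a u)
                    (eq : step23 a (3 + j) u ≡ carried j u) where
    private
      w₁ w₂ : Word
      w₁ = upd (1 + j) (u (1 + j) ∸ 1) u
      w₂ = upd (2 + j) 0 w₁

    v : Word
    v = step23 a (3 + j) u

    v3 : v (3 + j) ≡ suc (u (3 + j))
    v3 = via eq (trans (upd-same (3 + j) _ w₂) (+-comm _ 1))

    v2 : v (2 + j) ≡ 0
    v2 = via eq (trans (upd-other (3 + j) _ w₂ (2 + j) (λ ())) (upd-same (2 + j) 0 w₁))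

    v1 : v (1 + j) ≡ u (1 + j) ∸ 1
    v1 = via eq (trans (upd-other (3 + j) _ w₂ (1 + j) (λ ()))
                  (trans (upd-other (2 + j) 0 w₁ (1 + j) (λ ())) (upd-same (1 + j) _ u)))

    v3≢0 : v (3 + j) ≢ 0
    v3≢0 v3≡0 = 1+n≢0 (trans (sym v3) v3≡0)

    v2-not-full : v (2 + j) ≢ a (2 + j)
    v2-not-full full = a≢0 (1 + j) (trans (sym full) v2)

    v1-not-full : 1 ≤ j → v (1 + j) ≢ a (1 + j)
    v1-not-full 1≤j full =
      <-irrefl (trans (sym v1) full) (pred-below (bu (1 + j) (s≤s 1≤j)) (a-pos (1 + j) (s≤s z≤n)))

module Algorithm2 (a : ℕ → ℕ) (a-pos : ∀ i → 1 ≤ i → 1 ≤ a i) (n : ℕ) where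

  open CarryRule a a-pos

  record Alg2Inv (t : ℕ) (u : Word) : Set where
    field
      bounded : Bounded a u
      vanish  : ∀ i → 3 + n ≤ i → u i ≡ 0
      safe    : ∀ i → 4 + i ≤ t → ¬ Hazard u i

  open Alg2Inv

  -- A hazard at i ≤ j after the step at 3 + j: by the offset of j above i, either it
  -- lies entirely below the window (and was there before), or the step must have
  -- fired on it (i = j, idle case) or it overlaps the freshly carried digits.
  safe-after-step : ∀ j u → Alg2Inv (3 + j) u → ∀ i → i ≤ j → ¬ Hazard (step23 a (3 + j) u) i
  safe-after-step j u old i i≤j hz@(v4-full , v3≡0 , v2-full , _) with offset-of i≤j | carry j u
  ... | offset zero    | idle ¬f eq = ¬f (hazard-fires {u} (subst (λ w → Hazard w i) eq hz))
  ... | offset (suc d) | idle _ eq = safe old i (s≤s (s≤s (s≤s (s≤s (m≤n+m i d)))))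
                                        (subst (λ w → Hazard w i) eq hz)
  ... | offset zero    | fires _ eq = AfterCarry.v3≢0 i u (bounded old) eq v3≡0
  ... | offset 1       | fires _ eq =
        AfterCarry.v1-not-full (1 + i) u (bounded old) eq (s≤s z≤n) v2-full
  ... | offset 2       | fires _ eq = AfterCarry.v2-not-full (2 + i) u (bounded old) eq v4-full
  ... | offset 3       | fires _ eq =
        AfterCarry.v1-not-full (3 + i) u (bounded old) eq (s≤s z≤n) v4-full
  ... | offset (suc (suc (suc (suc d)))) | fires _ _ =
        safe old i (s≤s (s≤s (s≤s (s≤s (m≤n+m i (3 + d)))))) (hazard-agree below hz)
    where
    below : ∀ p → p < 5 + i → step23 a (3 + (4 + d + i)) u p ≡ u p
    below p p<5+i =
      carry-agree (4 + d + i) u (inj₁ (≤-trans p<5+i (s≤s (s≤s (s≤s (s≤s (s≤s (m≤n+m i d))))))))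

  alg2-step : ∀ j u → 3 + j ≤ 2 + n → Alg2Inv (3 + j) u → Alg2Inv (4 + j) (step23 a (3 + j) u)
  alg2-step j u room old = record
    { bounded = carry-bounded j u (bounded old)
    ; vanish  = λ i 3+n≤i → trans (carry-agree j u (inj₂ (≤-trans (s≤s room) 3+n≤i))) (vanish old i 3+n≤i)
    ; safe    = λ i 4+i≤4+j → safe-after-step j u old i (≤-pred (≤-pred (≤-pred (≤-pred 4+i≤4+j))))
    }

  alg2-run : ∀ d j u → j + d ≡ n → Alg2Inv (3 + j) u → Alg2Inv (3 + n) (runUp (step23 a) (3 + j) d u)
  alg2-run zero    j u eq inv = subst (λ t → Alg2Inv (3 + t) u) (trans (sym (+-identityʳ j)) eq) inv
  alg2-run (suc d) j u eq inv =
    alg2-run d (suc j) (step23 a (3 + j) u) (trans (sym (+-suc j d)) eq) (alg2-step j u room inv)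
    where
    room : 3 + j ≤ 2 + n
    room = s≤s (s≤s (subst (suc j ≤_) eq (subst (suc j ≤_) (sym (+-suc j d)) (s≤s (m≤m+n j d)))))

  alg2-result : ∀ z → Bounded a z → (∀ i → 2 + n ≤ i → z i ≡ 0) →
    let w = runUp (step23 a) 3 n z in
    Bounded a w × (∀ i → 3 + n ≤ i → w i ≡ 0) × (∀ i → ¬ Hazard w i)
  alg2-result z bz vz = bounded inv , vanish inv , hazard-free
    where
    inv : Alg2Inv (3 + n) (runUp (step23 a) 3 n z)
    inv = alg2-run n 0 z refl record
      { bounded = bz
      ; vanish  = λ i 3+n≤i → vz i (≤-trans (n≤1+n _) 3+n≤i)
      ; safe    = λ i 4+i≤3 → ⊥-elim (<-irrefl refl (≤-trans (s≤s (s≤s (s≤s (s≤s z≤n)))) 4+i≤3))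
      }
    hazard-free : ∀ i → ¬ Hazard (runUp (step23 a) 3 n z) i
    hazard-free i hz@(w4-full , _) with 4 + i ≤? 3 + n
    ... | yes 4+i≤3+n = safe inv i 4+i≤3+n hz
    ... | no 4+i≰3+n  = a≢0 (3 + i) (trans (sym w4-full) (vanish inv (4 + i) (<⇒≤ (≰⇒> 4+i≰3+n))))

module Algorithm3 (a : ℕ → ℕ) (a-pos : ∀ i → 1 ≤ i → 1 ≤ a i) (n : ℕ) (w : Word)
                  (w-bounded : Bounded a w) (w-vanish : ∀ i → 3 + n ≤ i → w i ≡ 0)
                  (w-safe : ∀ i → ¬ CarryRule.Hazard a a-pos w i) where

  open CarryRule a a-pos

  -- The situation after the step at 3 + j: no full digit stands above a nonzero one
  -- at positions ≥ 1 + j; positions ≤ j still hold w; the digits at 2 + j and 1 + j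
  -- either have just been carried or are those of w (the one at 2 + j possibly
  -- lowered by the previous carry); and there is no hazard at j − 1.
  record Alg3Inv (j : ℕ) (u : Word) : Set where
    field
      bounded : Bounded a u
      clean   : ∀ k → 1 + j ≤ k → k ≤ 2 + n → u (suc k) ≡ a (suc k) → u k ≡ 0
      below   : ∀ i → i ≤ j → u i ≡ w i
      near    : (u (2 + j) ≡ 0 × u (1 + j) ≡ w (1 + j) ∸ 1)
              ⊎ ((u (2 + j) ≡ w (2 + j) ⊎ u (2 + j) ≡ w (2 + j) ∸ 1) × u (1 + j) ≡ w (1 + j))
      safe    : ∀ i → suc i ≡ j → ¬ Hazard u i

  open Alg3Inv

  -- Before any step (v_{m+3} = w, with m + 3 = 3 + (1 + n)).
  alg3-start : Alg3Inv (suc n) w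
  alg3-start = record
    { bounded = w-bounded
    ; clean   = λ k 2+n≤k _ full → ⊥-elim (a≢0 k (trans (sym full) (w-vanish (suc k) (s≤s 2+n≤k))))
    ; below   = λ _ _ → refl
    ; near    = inj₂ (inj₁ refl , refl)
    ; safe    = λ i _ → w-safe i
    }

  after-fire : ∀ j u → Alg3Inv (suc j) u → Fires j u → step23 a (3 + j) u ≡ carried j u →
               Alg3Inv j (step23 a (3 + j) u)
  after-fire j u old (_ , u2-full , 0<u1) eq = record
    { bounded = carry-bounded j u (bounded old)
    ; clean   = clean′
    ; below   = λ i i≤j → trans (carry-agree j u (inj₁ (s≤s i≤j))) (below old i (m≤n⇒m≤1+n i≤j))
    ; near    = inj₁ (v2 , trans v1 (cong (_∸ 1) (below old (1 + j) ≤-refl)))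
    ; safe    = λ { i refl (_ , _ , v1-full , _) → v1-not-full (s≤s z≤n) v1-full }
    }
    where
    open AfterCarry j u (bounded old) eq
    above : ∀ {k} → 3 + j < k → v k ≡ u k
    above 3+j<k = carry-agree j u (inj₂ 3+j<k)
    clean′ : ∀ k → 1 + j ≤ k → k ≤ 2 + n → v (suc k) ≡ a (suc k) → v k ≡ 0
    clean′ k 1+j≤k k≤2+n full with offset-of (<⇒≤ 1+j≤k)
    ... | offset zero = ⊥-elim (<-irrefl refl 1+j≤k)
    ... | offset 1    = ⊥-elim (v2-not-full full)
    ... | offset 2    = v2
    -- a full digit at 4 + j above the carried 3 + j would have been a hazard at j
    ... | offset 3    = ⊥-elim (safe old j refl (u4-full , u3-zero , u2-full , 0<u1))
      where
      u4-full : u (4 + j) ≡ a (4 + j)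
      u4-full = trans (sym (above ≤-refl)) full
      u3-zero : u (3 + j) ≡ 0
      u3-zero = clean old (3 + j) (n≤1+n _) k≤2+n u4-full
    ... | offset (suc (suc (suc (suc d)))) =
          trans (above 3+j<k) (clean old k (≤-trans (n≤1+n _) 3+j≤k) k≤2+n
                                 (trans (sym (above (m<n⇒m<1+n 3+j<k))) full))
      where
      3+j≤k : 3 + j ≤ k
      3+j≤k = s≤s (s≤s (s≤s (m≤n+m j (suc d))))
      3+j<k : 3 + j < k
      3+j<k = s≤s (s≤s (s≤s (s≤s (m≤n+m j d))))

  -- Two positions below the last step there is never a hazard: its full digit at
  -- 4 + i could only have been inherited from w, together with the digits below it.
  no-hazard-below : ∀ i u → Alg3Inv (2 + i) u → ¬ Hazard u i
  no-hazard-below i u inv hz@(u4-full , u3-zero , u2-full , 0<u1) with near inv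
  ... | inj₁ (u4≡0 , _) = a≢0 (3 + i) (trans (sym u4-full) u4≡0)
  ... | inj₂ (inj₂ u4≡w4-1 , _) =
        <-irrefl (trans (sym u4≡w4-1) u4-full) (pred-below (w-bounded (4 + i) (s≤s (s≤s z≤n)))
                                                            (a-pos (4 + i) (s≤s z≤n)))
  ... | inj₂ (inj₁ u4≡w4 , u3≡w3) = w-safe i
        ( trans (sym u4≡w4) u4-full , trans (sym u3≡w3) u3-zero
        , trans (sym (below inv (2 + i) ≤-refl)) u2-full
        , subst (0 <_) (below inv (1 + i) (n≤1+n _)) 0<u1 )

  after-idle : ∀ j u → j ≤ n → Alg3Inv (suc j) u → ¬ Fires j u → Alg3Inv j u
  after-idle j u j≤n old ¬f = record
    { bounded = bounded old
    ; clean   = clean′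
    ; below   = λ i i≤j → below old i (m≤n⇒m≤1+n i≤j)
    ; near    = inj₂ (near-upper (near old) , below old (1 + j) ≤-refl)
    ; safe    = λ { i refl → no-hazard-below i u old }
    }
    where
    near-upper : (u (3 + j) ≡ 0 × u (2 + j) ≡ w (2 + j) ∸ 1)
               ⊎ ((u (3 + j) ≡ w (3 + j) ⊎ u (3 + j) ≡ w (3 + j) ∸ 1) × u (2 + j) ≡ w (2 + j))
               → u (2 + j) ≡ w (2 + j) ⊎ u (2 + j) ≡ w (2 + j) ∸ 1
    near-upper (inj₁ (_ , lowered)) = inj₂ lowered
    near-upper (inj₂ (_ , kept))    = inj₁ kept
    -- A full digit at 2 + j over a nonzero 1 + j would have fired, unless 3 + j is
    -- full as well; but then the pair (3 + j, 2 + j) was already clean.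
    clean′ : ∀ k → 1 + j ≤ k → k ≤ 2 + n → u (suc k) ≡ a (suc k) → u k ≡ 0
    clean′ k 1+j≤k k≤2+n full with m≤n⇒m<n∨m≡n 1+j≤k
    ... | inj₁ 1+j<k = clean old k 1+j<k k≤2+n full
    ... | inj₂ refl with u (1 + j) ≟ 0 | u (3 + j) <? a (3 + j)
    ...   | yes u1≡0 | _         = u1≡0
    ...   | no u1≢0  | yes u3<a3 = ⊥-elim (¬f (u3<a3 , full , n≢0⇒n>0 u1≢0))
    ...   | no _     | no u3≮a3  = ⊥-elim (a≢0 (1 + j) (trans (sym full) u2≡0))
      where
      u3-full : u (3 + j) ≡ a (3 + j)
      u3-full = ≤-antisym (bounded old (3 + j) (s≤s (s≤s z≤n))) (≮⇒≥ u3≮a3)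
      u2≡0 : u (2 + j) ≡ 0
      u2≡0 = clean old (2 + j) ≤-refl (s≤s (s≤s j≤n)) u3-full

  alg3-step : ∀ j u → j ≤ n → Alg3Inv (suc j) u → Alg3Inv j (step23 a (3 + j) u)
  alg3-step j u j≤n old with carry j u
  ... | fires f eq = after-fire j u old f eq
  ... | idle ¬f eq = subst (Alg3Inv j) (sym eq) (after-idle j u j≤n old ¬f)

  alg3-run : ∀ d j → 3 + j + d ≡ 4 + n → Alg3Inv j (runDown (step23 a) (3 + j) d w)
  alg3-run zero    j eq = subst (λ t → Alg3Inv t w) (sym j≡1+n) alg3-start
    where
    j≡1+n : j ≡ suc n
    j≡1+n = suc-injective (suc-injective (suc-injective (trans (sym (+-identityʳ _)) eq)))
  alg3-run (suc d) j eq = alg3-step j _ j≤n (alg3-run d (suc j) eq′)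
    where
    eq′ : 3 + suc j + d ≡ 4 + n
    eq′ = trans (cong (3 +_) (sym (+-suc j d))) eq
    j≤n : j ≤ n
    j≤n = subst (j ≤_) (suc-injective (suc-injective (suc-injective (suc-injective eq′)))) (m≤m+n j d)

module Pipeline (a : ℕ → ℕ) (a-pos : ∀ i → 1 ≤ i → 1 ≤ a i) (n : ℕ) (1≤n : 1 ≤ n)
                (x y : Word) (M N : ℕ)
                (ox : IsOstrowskiRep a n x M) (oy : IsOstrowskiRep a n y N) where

  open DigitSum a a-pos n x y M N ox oy using (s-outside; s-capped)
  open CarryRule a a-pos using (Hazard)

  z-facts : Bounded a (zSeq a n x y 3) × (∀ i → 2 + n ≤ i → zSeq a n x y 3 i ≡ 0)
  z-facts = Algorithm1.alg1-result a a-pos n (sWord n x y) s-outside s-capped _ steps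
    where
    steps : 3 + (suc n + 1 ∸ 3) ≡ 2 + n
    steps = trans (m+[n∸m]≡n (s≤s (+-monoˡ-≤ 1 1≤n))) (cong suc (+-comm n 1))

  w-facts : Bounded a (wFinal a n x y) × (∀ i → 3 + n ≤ i → wFinal a n x y i ≡ 0)
            × (∀ i → ¬ Hazard (wFinal a n x y) i)
  w-facts = Algorithm2.alg2-result a a-pos n (zSeq a n x y 3) (proj₁ z-facts) (proj₂ z-facts)

  v-clean : ∀ j → 3 + j ≤ n + 4 → ∀ k → 1 + j ≤ k → k ≤ 2 + n →
            vSeq a n x y (3 + j) (suc k) ≡ a (suc k) → vSeq a n x y (3 + j) k ≡ 0
  v-clean j 3+j≤n+4 = Alg3Inv.clean (alg3-run (suc n + 3 ∸ (3 + j)) j steps)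
    where
    open Algorithm3 a a-pos n (wFinal a n x y)
                    (proj₁ w-facts) (proj₁ (proj₂ w-facts)) (proj₂ (proj₂ w-facts))
    steps : 3 + j + (suc n + 3 ∸ (3 + j)) ≡ 4 + n
    steps = trans (m+[n∸m]≡n (subst (3 + j ≤_) (+-suc n 3) 3+j≤n+4)) (cong suc (+-comm n 3))

-- Theorem: for 3 ≤ l ≤ m + 3 there is no k with max(l − 1, 2) ≤ k ≤ m + 2 such that
-- v_{l,k} = a_k and v_{l,k−1} > 0.  Writing l = 3 + j and k = 1 + k′, this is v-clean.
mainTheorem9 : (a : ℕ → ℕ) → (∀ i → 1 ≤ i → 1 ≤ a i) →
    (M N n : ℕ) → 1 ≤ n → (x y : Word) →
    IsOstrowskiRep a n x M → IsOstrowskiRep a n y N →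
    (l : ℕ) → 3 ≤ l → l ≤ (n + 1) + 3 →
    ¬ (Σ ℕ (λ k → ((l ∸ 1) ⊔ 2) ≤ k × k ≤ (n + 1) + 2 ×
         vSeq a n x y l k ≡ a k × 0 < vSeq a n x y l (k ∸ 1)))
mainTheorem9 a a-pos M N n 1≤n x y ox oy (suc (suc (suc j))) (s≤s (s≤s (s≤s z≤n))) l≤m+3
             (k , k-lo , k≤m+2 , full , pos)
  with ≤-trans (m≤m⊔n (2 + j) 2) k-lo
... | s≤s {n = k′} 1+j≤k′ = <-irrefl (sym (v-clean j l≤n+4 k′ 1+j≤k′ k′≤2+n full)) pos
  where
  open Pipeline a a-pos n 1≤n x y M N ox oy
  l≤n+4 : 3 + j ≤ n + 4
  l≤n+4 = subst (3 + j ≤_) (+-assoc n 1 3) l≤m+3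
  k′≤2+n : k′ ≤ 2 + n
  k′≤2+n = ≤-pred (subst (suc k′ ≤_) (trans (+-assoc n 1 2) (+-comm n 3)) k≤m+2)
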